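{- Let $M$ be a loopless matroid on a finite set $E$ with rank function $r$. Let $B \subseteq E$ be nonempty and $e \in E\setminus B$ such that $r'(B \cup \{e\}) = |B \cup\{e\}|$. Then the function $f: 2^B \to \mathbb{Q}$ given by \[ f(I) := 2r(I\cup\{e\}) - 1 - |I\cup\{e\}| - \frac{|I|}{2|B|} \] is submodular, and a set $J \subseteq B$ is a largest (maximum cardinality) subset of $B$ with $2r(J\cup\{e\}) - 1 = |J\cup\{e\}|$ if and only if $f(J) = \min_{I\subseteq B} f(I)$.
   Context: $r'(S) := \min \sum_{i=1}^k (2r(P_i)-1)$, the minimum over all partitions $\{P_1,\ldots,P_k\}$ of $S$ into pairwise disjoint nonempty subsets with union $S$. -}

module Defs where

open import Data.Nat as ℕ using (ℕ; zero; suc; NonZero)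
open import Data.Integer as ℤ using (ℤ; +_)
open import Data.Rational as ℚ using (ℚ)
open import Data.Fin using (Fin)
open import Data.Fin.Subset
open import Data.Fin.Subset.Properties using (drop-there)
open import Data.Vec using (_∷_)
open import Data.List using (List; map; foldr)
open import Data.List.Relation.Unary.All using (All)
open import Data.List.Relation.Unary.AllPairs using (AllPairs)
open import Data.Product using (Σ; _×_; _,_; ∃)
open import Data.Nat.Properties using (m*n≢0)
open import Relation.Binary.PropositionalEquality using (_≡_)

record Matroid (n : ℕ) : Set where
  field
    r          : Subset n → ℕ
    r-≤-card   : ∀ X → r X ℕ.≤ ∣ X ∣
    r-mono     : ∀ {X Y} → X ⊆ Y → r X ℕ.≤ r Y
    r-submod   : ∀ X Y → r (X ∪ Y) ℕ.+ r (X ∩ Y) ℕ.≤ r X ℕ.+ r Y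
open Matroid public

Loopless : ∀ {n} → Matroid n → Set
Loopless {n} M = ∀ (x : Fin n) → r M ⁅ x ⁆ ≡ 1

2r-1 : ∀ {n} → Matroid n → Subset n → ℤ
2r-1 M X = ℤ.+ 2 ℤ.* ℤ.+ r M X ℤ.- ℤ.+ 1

IsPartition : ∀ {n} → List (Subset n) → Subset n → Set
IsPartition Ps S =
  All Nonempty Ps × AllPairs (λ P Q → P ∩ Q ≡ ⊥) Ps × foldr _∪_ ⊥ Ps ≡ S

partCost : ∀ {n} → Matroid n → List (Subset n) → ℤ
partCost M Ps = foldr ℤ._+_ (+ 0) (map (2r-1 M) Ps)

r'≡ : ∀ {n} → Matroid n → Subset n → ℤ → Set
r'≡ {n} M S m =
  (Σ (List (Subset n)) λ Ps → IsPartition Ps S × partCost M Ps ≡ m)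
  × (∀ (Ps : List (Subset n)) → IsPartition Ps S → m ℤ.≤ partCost M Ps)

nonempty⇒nonZero : ∀ {n} (B : Subset n) → Nonempty B → NonZero ∣ B ∣
nonempty⇒nonZero (inside ∷ B) _ = _
nonempty⇒nonZero (outside ∷ B) (Fin.suc x , x∈) = nonempty⇒nonZero B (x , drop-there x∈)
  where import Data.Fin as Fin

f : ∀ {n} → Matroid n → (B : Subset n) → Nonempty B → Fin n → Subset n → ℚ
f M B neB e I =
  ((2r-1 M (I ∪ ⁅ e ⁆) ℤ.- + ∣ I ∪ ⁅ e ⁆ ∣) ℚ./ 1)
  ℚ.- ((+ ∣ I ∣) ℚ./ (2 ℕ.* ∣ B ∣))
  where instance
          _ : NonZero (2 ℕ.* ∣ B ∣)
          _ = m*n≢0 2 ∣ B ∣ {{_}} {{nonempty⇒nonZero B neB}}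

Tight : ∀ {n} → Matroid n → Fin n → Subset n → Set
Tight M e J = 2r-1 M (J ∪ ⁅ e ⁆) ≡ + ∣ J ∪ ⁅ e ⁆ ∣

LargestTight : ∀ {n} → Matroid n → Subset n → Fin n → Subset n → Set
LargestTight {n} M B e J =
  J ⊆ B × Tight M e J × (∀ (K : Subset n) → K ⊆ B → Tight M e K → ∣ K ∣ ℕ.≤ ∣ J ∣)

{-# OPTIONS --safe #-}
-- Let s(X) = 2r(X) - 1 - |X|. As r is submodular and |·| is modular, s is submodular, and so is
-- f(I) = s(I ∪ {e}) - |I|/(2|B|). Splitting B ∪ {e} into a nonempty part Q and singletons, each of
-- cost 1 in a loopless matroid, the hypothesis r'(B ∪ {e}) = |B ∪ {e}| yields s(Q) ≥ 0 for every
-- nonempty Q ⊆ B ∪ {e}. Hence 2|B| f(I) is -|I| when s(I ∪ {e}) = 0, i.e. when I is tight, and at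
-- least |B| > 0 otherwise; as ∅ is tight, the minimisers of f are exactly the largest tight sets.
module Submission where

open import Defs
open import Data.Nat using (ℕ)
open import Data.Fin using (Fin)
open import Data.Fin.Subset using (Subset; _⊆_; _∪_; _∩_; _∉_; ⁅_⁆; ∣_∣; Nonempty)
open import Data.Product using (_×_; _,_)
open import Function.Bundles using (_⇔_)

module CommonDenominator where
  open import Data.Nat as ℕ using (suc; NonZero)
  import Data.Nat.Properties as ℕ
  open import Data.Integer as ℤ using (+_)
  import Data.Integer.Properties as ℤP
  open import Data.Integer.Tactic.RingSolver using (solve-∀)
  open import Data.Rational as ℚ using (_/_; _+_; _-_; _≤_; toℚᵘ)
  open import Data.Rational.Properties
    using (toℚᵘ-fromℚᵘ; toℚᵘ-injective; toℚᵘ-homo-+; toℚᵘ-homo‿-; toℚᵘ-mono-≤; toℚᵘ-cancel-≤)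
  open import Data.Rational.Unnormalised as ℚᵘ using (mkℚᵘ; *≤*)
  import Data.Rational.Unnormalised.Properties as ℚᵘ
  open import Relation.Binary.PropositionalEquality using (_≡_; refl; sym)

  toℚᵘ-/ : ∀ i n .{{_ : NonZero n}} → toℚᵘ (i / n) ℚᵘ.≃ (i ℚᵘ./ n)
  toℚᵘ-/ i (suc k) = toℚᵘ-fromℚᵘ (mkℚᵘ i k)

  i/n+j/n≡[i+j]/n : ∀ i j n .{{_ : NonZero n}} → (i / n) + (j / n) ≡ (i ℤ.+ j) / n
  i/n+j/n≡[i+j]/n i j n@(suc _) = toℚᵘ-injective (begin
    toℚᵘ (i / n + j / n)                     ≈⟨ toℚᵘ-homo-+ (i / n) (j / n) ⟩
    toℚᵘ (i / n) ℚᵘ.+ toℚᵘ (j / n)           ≈⟨ ℚᵘ.+-cong (toℚᵘ-/ i n) (toℚᵘ-/ j n) ⟩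
    (i ℤ.* + n ℤ.+ j ℤ.* + n) ℚᵘ./ (n ℕ.* n) ≡⟨ ℚᵘ./-cong (sym (ℤP.*-distribʳ-+ (+ n) i j)) refl ⟩
    ((i ℤ.+ j) ℤ.* + n) ℚᵘ./ (n ℕ.* n)       ≈⟨ ℚᵘ.*-cancelʳ-/ n ⟩
    (i ℤ.+ j) ℚᵘ./ n                         ≈⟨ toℚᵘ-/ (i ℤ.+ j) n ⟨
    toℚᵘ ((i ℤ.+ j) / n)                     ∎)
    where
    open ℚᵘ.≃-Reasoning

  i/1-j/n≡[n*i-j]/n : ∀ i j n .{{_ : NonZero n}} → (i / 1) - (j / n) ≡ (+ n ℤ.* i ℤ.- j) / n
  i/1-j/n≡[n*i-j]/n i j n@(suc _) = toℚᵘ-injective (begin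
    toℚᵘ (i / 1 - j / n)                          ≈⟨ toℚᵘ-homo-+ (i / 1) (ℚ.- (j / n)) ⟩
    toℚᵘ (i / 1) ℚᵘ.+ toℚᵘ (ℚ.- (j / n))          ≈⟨ ℚᵘ.+-cong (toℚᵘ-/ i 1) toℚᵘ[-j/n] ⟩
    (i ℤ.* + n ℤ.+ ℤ.- j ℤ.* + 1) ℚᵘ./ (1 ℕ.* n) ≡⟨ ℚᵘ./-cong (rearrange i j (+ n)) (ℕ.*-identityˡ n) ⟩
    (+ n ℤ.* i ℤ.- j) ℚᵘ./ n                      ≈⟨ toℚᵘ-/ (+ n ℤ.* i ℤ.- j) n ⟨
    toℚᵘ ((+ n ℤ.* i ℤ.- j) / n)                  ∎)
    where
    open ℚᵘ.≃-Reasoning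
    toℚᵘ[-j/n] : toℚᵘ (ℚ.- (j / n)) ℚᵘ.≃ ℚᵘ.- (j ℚᵘ./ n)
    toℚᵘ[-j/n] = ℚᵘ.≃-trans (toℚᵘ-homo‿- (j / n)) (ℚᵘ.-‿cong (toℚᵘ-/ j n))
    rearrange : ∀ i j m → i ℤ.* m ℤ.+ ℤ.- j ℤ.* + 1 ≡ m ℤ.* i ℤ.- j
    rearrange = solve-∀

  /-monoˡ-≤ : ∀ {i j} n .{{_ : NonZero n}} → i ℤ.≤ j → i / n ≤ j / n
  /-monoˡ-≤ {i} {j} n@(suc _) i≤j = toℚᵘ-cancel-≤
    (ℚᵘ.≤-respˡ-≃ (ℚᵘ.≃-sym (toℚᵘ-/ i n)) (ℚᵘ.≤-respʳ-≃ (ℚᵘ.≃-sym (toℚᵘ-/ j n))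
      (*≤* (ℤP.*-monoʳ-≤-nonNeg (+ n) i≤j))))

  /-cancelˡ-≤ : ∀ {i j} n .{{_ : NonZero n}} → i / n ≤ j / n → i ℤ.≤ j
  /-cancelˡ-≤ {i} {j} n@(suc _) i/n≤j/n
    with ℚᵘ.≤-respˡ-≃ (toℚᵘ-/ i n) (ℚᵘ.≤-respʳ-≃ (toℚᵘ-/ j n) (toℚᵘ-mono-≤ i/n≤j/n))
  ... | *≤* i*n≤j*n = ℤP.*-cancelʳ-≤-pos i j (+ n) i*n≤j*n

module SubsetAlgebra where
  open import Data.Nat using (suc; _+_)
  open import Data.Nat.Properties using (+-suc; +-identityʳ)
  open import Data.Fin.Subset
  open import Data.Fin.Subset.Properties
  open import Data.Vec using ([]; _∷_; here)
  open import Data.Sum using (inj₁; inj₂)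
  open import Relation.Binary.PropositionalEquality
  import Algebra.Properties.IdempotentCommutativeMonoid as ICM

  private variable
    n : ℕ
    p q s : Subset n

  ∣p∪q∣+∣p∩q∣≡∣p∣+∣q∣ : ∀ (p q : Subset n) → ∣ p ∪ q ∣ + ∣ p ∩ q ∣ ≡ ∣ p ∣ + ∣ q ∣
  ∣p∪q∣+∣p∩q∣≡∣p∣+∣q∣ []            []            = refl
  ∣p∪q∣+∣p∩q∣≡∣p∣+∣q∣ (outside ∷ p) (outside ∷ q) = ∣p∪q∣+∣p∩q∣≡∣p∣+∣q∣ p q
  ∣p∪q∣+∣p∩q∣≡∣p∣+∣q∣ (inside  ∷ p) (outside ∷ q) = cong suc (∣p∪q∣+∣p∩q∣≡∣p∣+∣q∣ p q)
  ∣p∪q∣+∣p∩q∣≡∣p∣+∣q∣ (outside ∷ p) (inside  ∷ q) =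
    trans (cong suc (∣p∪q∣+∣p∩q∣≡∣p∣+∣q∣ p q)) (sym (+-suc ∣ p ∣ ∣ q ∣))
  ∣p∪q∣+∣p∩q∣≡∣p∣+∣q∣ (inside  ∷ p) (inside  ∷ q) = cong suc (begin
    ∣ p ∪ q ∣ + suc ∣ p ∩ q ∣   ≡⟨ +-suc ∣ p ∪ q ∣ ∣ p ∩ q ∣ ⟩
    suc (∣ p ∪ q ∣ + ∣ p ∩ q ∣) ≡⟨ cong suc (∣p∪q∣+∣p∩q∣≡∣p∣+∣q∣ p q) ⟩
    suc (∣ p ∣ + ∣ q ∣)         ≡⟨ +-suc ∣ p ∣ ∣ q ∣ ⟨
    ∣ p ∣ + suc ∣ q ∣           ∎)
    where open ≡-Reasoning

  p∩q≡⊥⇒∣p∪q∣≡∣p∣+∣q∣ : ∀ (p q : Subset n) → p ∩ q ≡ ⊥ → ∣ p ∪ q ∣ ≡ ∣ p ∣ + ∣ q ∣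
  p∩q≡⊥⇒∣p∪q∣≡∣p∣+∣q∣ {n} p q p∩q≡⊥ = begin
    ∣ p ∪ q ∣               ≡⟨ +-identityʳ ∣ p ∪ q ∣ ⟨
    ∣ p ∪ q ∣ + 0           ≡⟨ cong (∣ p ∪ q ∣ +_) (∣⊥∣≡0 n) ⟨
    ∣ p ∪ q ∣ + ∣ ⊥ {n} ∣   ≡⟨ cong (λ t → ∣ p ∪ q ∣ + ∣ t ∣) p∩q≡⊥ ⟨
    ∣ p ∪ q ∣ + ∣ p ∩ q ∣   ≡⟨ ∣p∪q∣+∣p∩q∣≡∣p∣+∣q∣ p q ⟩
    ∣ p ∣ + ∣ q ∣           ∎
    where open ≡-Reasoning

  p⊆q⇒p∪[q─p]≡q : ∀ (p q : Subset n) → p ⊆ q → p ∪ (q ─ p) ≡ q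
  p⊆q⇒p∪[q─p]≡q []            []            _   = refl
  p⊆q⇒p∪[q─p]≡q (outside ∷ p) (outside ∷ q) p⊆q = cong (outside ∷_) (p⊆q⇒p∪[q─p]≡q p q (drop-∷-⊆ p⊆q))
  p⊆q⇒p∪[q─p]≡q (outside ∷ p) (inside  ∷ q) p⊆q = cong (inside ∷_) (p⊆q⇒p∪[q─p]≡q p q (drop-∷-⊆ p⊆q))
  p⊆q⇒p∪[q─p]≡q (inside  ∷ p) (inside  ∷ q) p⊆q = cong (inside ∷_) (p⊆q⇒p∪[q─p]≡q p q (drop-∷-⊆ p⊆q))
  p⊆q⇒p∪[q─p]≡q (inside  ∷ p) (outside ∷ q) p⊆q with () ← p⊆q here

  p∩[q─p]≡⊥ : ∀ (p q : Subset n) → p ∩ (q ─ p) ≡ ⊥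
  p∩[q─p]≡⊥ []            []      = refl
  p∩[q─p]≡⊥ (outside ∷ p) (_ ∷ q) = cong (outside ∷_) (p∩[q─p]≡⊥ p q)
  p∩[q─p]≡⊥ (inside  ∷ p) (_ ∷ q) = cong (outside ∷_) (p∩[q─p]≡⊥ p q)

  p∩q≡⊥∧s⊆q⇒p∩s≡⊥ : p ∩ q ≡ ⊥ → s ⊆ q → p ∩ s ≡ ⊥
  p∩q≡⊥∧s⊆q⇒p∩s≡⊥ {p = p} {s = s} p∩q≡⊥ s⊆q = ⊆-antisym p∩s⊆⊥ ⊥⊆
    where
    p∩s⊆⊥ : p ∩ s ⊆ ⊥
    p∩s⊆⊥ x∈p∩s with x∈p , x∈s ← x∈p∩q⁻ p s x∈p∩s = subst (_ ∈_) p∩q≡⊥ (x∈p∩q⁺ (x∈p , s⊆q x∈s))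

  ∪-monoˡ-⊆ : p ⊆ q → p ∪ s ⊆ q ∪ s
  ∪-monoˡ-⊆ {p = p} {s = s} p⊆q x∈p∪s with x∈p∪q⁻ p s x∈p∪s
  ... | inj₁ x∈p = x∈p∪q⁺ (inj₁ (p⊆q x∈p))
  ... | inj₂ x∈s = x∈p∪q⁺ (inj₂ x∈s)

  ∪-distribʳ-∪ : ∀ (s p q : Subset n) → (p ∪ q) ∪ s ≡ (p ∪ s) ∪ (q ∪ s)
  ∪-distribʳ-∪ {n} = ICM.∙-distrʳ-∙ (∪-idempotentCommutativeMonoid n)

module SetPartitions where
  import Data.Nat as ℕ
  open import Data.Fin using (zero; suc)
  open import Data.Fin.Subset
  open import Data.Fin.Subset.Properties
  open import Data.Vec using ([]; _∷_; here; there)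
  open import Data.List using (List; []; _∷_; map; length)
  open import Data.List.Properties using (length-map)
  open import Data.List.Relation.Unary.All as All using (All; []; _∷_)
  import Data.List.Relation.Unary.All.Properties as All
  open import Data.List.Relation.Unary.AllPairs as AllPairs using ([]; _∷_)
  import Data.List.Relation.Unary.AllPairs.Properties as AllPairs
  open import Data.Product using (∃)
  open import Relation.Binary.PropositionalEquality
  open SubsetAlgebra

  private variable
    n : ℕ
    Q S : Subset n
    Ps : List (Subset n)

  ⊆-⋃ : ∀ (Ps : List (Subset n)) → All (_⊆ ⋃ Ps) Ps
  ⊆-⋃ []       = []
  ⊆-⋃ (P ∷ Ps) = p⊆p∪q (⋃ Ps) ∷ All.map ⊆-∪ˡ (⊆-⋃ Ps)
    where
    ⊆-∪ˡ : ∀ {Q} → Q ⊆ ⋃ Ps → Q ⊆ P ∪ ⋃ Ps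
    ⊆-∪ˡ Q⊆⋃Ps = ⊆-trans Q⊆⋃Ps (q⊆p∪q P (⋃ Ps))

  ∷-isPartition : Nonempty Q → Q ∩ S ≡ ⊥ → IsPartition Ps S → IsPartition (Q ∷ Ps) (Q ∪ S)
  ∷-isPartition {Ps = Ps} Q≢∅ Q∩S≡⊥ (Ps≢∅ , Ps-disjoint , refl) =
    Q≢∅ ∷ Ps≢∅ , All.map (p∩q≡⊥∧s⊆q⇒p∩s≡⊥ Q∩S≡⊥) (⊆-⋃ Ps) ∷ Ps-disjoint , refl

  ⋃-map-outside∷ : ∀ (Ps : List (Subset n)) → ⋃ (map (outside ∷_) Ps) ≡ outside ∷ ⋃ Ps
  ⋃-map-outside∷ []       = refl
  ⋃-map-outside∷ (P ∷ Ps) = cong ((outside ∷ P) ∪_) (⋃-map-outside∷ Ps)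

  outside∷-isPartition : IsPartition Ps S → IsPartition (map (outside ∷_) Ps) (outside ∷ S)
  outside∷-isPartition {Ps = Ps} (Ps≢∅ , Ps-disjoint , refl) =
    All.map⁺ (All.map (λ (x , x∈P) → suc x , there x∈P) Ps≢∅) ,
    AllPairs.map⁺ (AllPairs.map (cong (outside ∷_)) Ps-disjoint) ,
    ⋃-map-outside∷ Ps

  singletons : Subset n → List (Subset n)
  singletons []            = []
  singletons (outside ∷ p) = map (outside ∷_) (singletons p)
  singletons (inside  ∷ p) = ⁅ zero ⁆ ∷ map (outside ∷_) (singletons p)

  singletons-isPartition : ∀ (p : Subset n) → IsPartition (singletons p) p
  singletons-isPartition []            = [] , [] , refl
  singletons-isPartition (outside ∷ p) = outside∷-isPartition (singletons-isPartition p)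
  singletons-isPartition (inside  ∷ p) =
    subst (IsPartition (singletons (inside ∷ p))) (cong (inside ∷_) (∪-identityˡ p))
      (∷-isPartition (zero , here) (cong (outside ∷_) (∩-zeroˡ p))
        (outside∷-isPartition (singletons-isPartition p)))

  IsSingleton : Subset n → Set
  IsSingleton P = ∃ λ x → P ≡ ⁅ x ⁆

  outside∷-isSingleton : ∀ {P : Subset n} → IsSingleton P → IsSingleton (outside ∷ P)
  outside∷-isSingleton (x , refl) = suc x , refl

  singletons-isSingleton : ∀ (p : Subset n) → All IsSingleton (singletons p)
  singletons-isSingleton []            = []
  singletons-isSingleton (outside ∷ p) = All.map⁺ (All.map outside∷-isSingleton (singletons-isSingleton p))
  singletons-isSingleton (inside  ∷ p) =
    (zero , refl) ∷ All.map⁺ (All.map outside∷-isSingleton (singletons-isSingleton p))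

  length-singletons : ∀ (p : Subset n) → length (singletons p) ≡ ∣ p ∣
  length-singletons []            = refl
  length-singletons (outside ∷ p) = trans (length-map (outside ∷_) (singletons p)) (length-singletons p)
  length-singletons (inside  ∷ p) =
    cong ℕ.suc (trans (length-map (outside ∷_) (singletons p)) (length-singletons p))

module SubmodularFunctions {n : ℕ} where
  open import Data.Integer using (ℤ; +_; _+_; _*_; -_; _≤_; NonNegative)
  open import Data.Integer.Properties
  open import Algebra.Properties.CommutativeSemigroup +-commutativeSemigroup using (interchange)
  open import Data.Fin.Subset.Properties using (∪-distribʳ-∩)
  open import Relation.Binary.PropositionalEquality using (sym; cong; cong₂; subst; module ≡-Reasoning)
  open import Function using (_∘_)
  import Data.Nat as ℕ
  open SubsetAlgebra using (∣p∪q∣+∣p∩q∣≡∣p∣+∣q∣; ∪-distribʳ-∪)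

  record Submodular (φ : Subset n → ℤ) : Set where
    constructor mkSubmodular
    field
      submodular : ∀ X Y → φ (X ∪ Y) + φ (X ∩ Y) ≤ φ X + φ Y

  open Submodular public

  const-submodular : ∀ c → Submodular (λ _ → c)
  const-submodular c = mkSubmodular λ _ _ → ≤-refl

  +-submodular : ∀ {φ ψ} → Submodular φ → Submodular ψ → Submodular (λ X → φ X + ψ X)
  +-submodular {φ} {ψ} φ-sub ψ-sub = mkSubmodular λ X Y → begin
    (φ (X ∪ Y) + ψ (X ∪ Y)) + (φ (X ∩ Y) + ψ (X ∩ Y)) ≡⟨ interchange (φ (X ∪ Y)) (ψ (X ∪ Y)) _ _ ⟩
    (φ (X ∪ Y) + φ (X ∩ Y)) + (ψ (X ∪ Y) + ψ (X ∩ Y)) ≤⟨ +-mono-≤ (submodular φ-sub X Y) (submodular ψ-sub X Y) ⟩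
    (φ X + φ Y) + (ψ X + ψ Y)                         ≡⟨ interchange (φ X) (φ Y) _ _ ⟩
    (φ X + ψ X) + (φ Y + ψ Y)                         ∎
    where open ≤-Reasoning

  *-submodular : ∀ c .{{_ : NonNegative c}} {φ} → Submodular φ → Submodular (λ X → c * φ X)
  *-submodular c {φ} φ-sub = mkSubmodular λ X Y → begin
    c * φ (X ∪ Y) + c * φ (X ∩ Y) ≡⟨ *-distribˡ-+ c _ _ ⟨
    c * (φ (X ∪ Y) + φ (X ∩ Y))   ≤⟨ *-monoˡ-≤-nonNeg c (submodular φ-sub X Y) ⟩
    c * (φ X + φ Y)               ≡⟨ *-distribˡ-+ c _ _ ⟩
    c * φ X + c * φ Y             ∎
    where open ≤-Reasoning

  ∪ʳ-submodular : ∀ s {φ} → Submodular φ → Submodular (λ X → φ (X ∪ s))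
  ∪ʳ-submodular s {φ} φ-sub = mkSubmodular λ X Y →
    subst (_≤ φ (X ∪ s) + φ (Y ∪ s))
      (cong₂ (λ U N → φ U + φ N) (sym (∪-distribʳ-∪ s X Y)) (sym (∪-distribʳ-∩ s X Y)))
      (submodular φ-sub (X ∪ s) (Y ∪ s))

  -card-submodular : Submodular (λ X → - + ∣ X ∣)
  -card-submodular = mkSubmodular λ X Y → ≤-reflexive (begin
    - + ∣ X ∪ Y ∣ + - + ∣ X ∩ Y ∣ ≡⟨ neg-distrib-+ (+ ∣ X ∪ Y ∣) (+ ∣ X ∩ Y ∣) ⟨
    - (+ ∣ X ∪ Y ∣ + + ∣ X ∩ Y ∣) ≡⟨ cong -_ (pos-+ ∣ X ∪ Y ∣ ∣ X ∩ Y ∣) ⟨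
    - + (∣ X ∪ Y ∣ ℕ.+ ∣ X ∩ Y ∣)  ≡⟨ cong (-_ ∘ +_) (∣p∪q∣+∣p∩q∣≡∣p∣+∣q∣ X Y) ⟩
    - + (∣ X ∣ ℕ.+ ∣ Y ∣)          ≡⟨ cong -_ (pos-+ ∣ X ∣ ∣ Y ∣) ⟩
    - (+ ∣ X ∣ + + ∣ Y ∣)          ≡⟨ neg-distrib-+ (+ ∣ X ∣) (+ ∣ Y ∣) ⟩
    - + ∣ X ∣ + - + ∣ Y ∣          ∎)
    where open ≡-Reasoning

module MatroidSurplus {n : ℕ} (M : Matroid n) where
  open import Data.Integer using (ℤ; +_; 0ℤ; _+_; _*_; -_; _-_; _≤_; +≤+)
  open import Data.Integer.Properties using (pos-+; i≡j⇒i-j≡0; i-j≡0⇒i≡j; i≤j⇒0≤j-i)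
  open import Data.Integer.Tactic.RingSolver using (solve-∀)
  open import Data.Fin.Subset using (_─_)
  open import Data.List using (List; []; _∷_; length)
  open import Data.List.Relation.Unary.All using (All; []; _∷_)
  open import Data.Product using (proj₂)
  open import Function.Bundles using (mk⇔)
  open import Relation.Binary.PropositionalEquality
  open SubsetAlgebra
  open SetPartitions
  open SubmodularFunctions

  surplus : Subset n → ℤ
  surplus X = 2r-1 M X - + ∣ X ∣

  2r-1≡∣X∣⇔surplus≡0 : ∀ {X} → 2r-1 M X ≡ + ∣ X ∣ ⇔ surplus X ≡ 0ℤ
  2r-1≡∣X∣⇔surplus≡0 = mk⇔ i≡j⇒i-j≡0 (i-j≡0⇒i≡j _ _)

  rank-submodular : Submodular (λ X → + r M X)
  rank-submodular = mkSubmodular λ X Y →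
    subst₂ _≤_ (pos-+ (r M (X ∪ Y)) (r M (X ∩ Y))) (pos-+ (r M X) (r M Y)) (+≤+ (r-submod M X Y))

  surplus-submodular : Submodular surplus
  surplus-submodular =
    +-submodular (+-submodular (*-submodular (+ 2) rank-submodular) (const-submodular (- + 1)))
      -card-submodular

  module _ (loopless : Loopless M) where

    2r-1[⁅x⁆]≡1 : ∀ x → 2r-1 M ⁅ x ⁆ ≡ + 1
    2r-1[⁅x⁆]≡1 x = cong (λ k → + 2 * + k - + 1) (loopless x)

    partCost-singletons : ∀ Ps → All IsSingleton Ps → partCost M Ps ≡ + length Ps
    partCost-singletons []       []                         = refl
    partCost-singletons (_ ∷ Ps) ((x , refl) ∷ Ps-singleton) =
      cong₂ _+_ (2r-1[⁅x⁆]≡1 x) (partCost-singletons Ps Ps-singleton)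

    r'≡∣S∣⇒surplus-nonNeg : ∀ {S Q} → r'≡ M S (+ ∣ S ∣) → Q ⊆ S → Nonempty Q → 0ℤ ≤ surplus Q
    r'≡∣S∣⇒surplus-nonNeg {S} {Q} r'[S]≡∣S∣ Q⊆S Q≢∅ =
      subst (0ℤ ≤_) (cancel (2r-1 M Q) (+ ∣ Q ∣) (+ ∣ S ─ Q ∣)) (i≤j⇒0≤j-i bound)
      where
      Q∪[S─Q]≡S : Q ∪ (S ─ Q) ≡ S
      Q∪[S─Q]≡S = p⊆q⇒p∪[q─p]≡q Q S Q⊆S

      Ps : List (Subset n)
      Ps = Q ∷ singletons (S ─ Q)

      Ps-partition : IsPartition Ps S
      Ps-partition = subst (IsPartition Ps) Q∪[S─Q]≡S
        (∷-isPartition Q≢∅ (p∩[q─p]≡⊥ Q S) (singletons-isPartition (S ─ Q)))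

      cost : partCost M Ps ≡ 2r-1 M Q + + ∣ S ─ Q ∣
      cost = cong (λ k → 2r-1 M Q + k) (trans
        (partCost-singletons (singletons (S ─ Q)) (singletons-isSingleton (S ─ Q)))
        (cong +_ (length-singletons (S ─ Q))))

      ∣S∣ : + ∣ S ∣ ≡ + ∣ Q ∣ + + ∣ S ─ Q ∣
      ∣S∣ = trans (cong (λ T → + ∣ T ∣) (sym Q∪[S─Q]≡S))
        (trans (cong +_ (p∩q≡⊥⇒∣p∪q∣≡∣p∣+∣q∣ Q (S ─ Q) (p∩[q─p]≡⊥ Q S))) (pos-+ ∣ Q ∣ ∣ S ─ Q ∣))

      bound : + ∣ Q ∣ + + ∣ S ─ Q ∣ ≤ 2r-1 M Q + + ∣ S ─ Q ∣
      bound = subst₂ _≤_ ∣S∣ cost (proj₂ r'[S]≡∣S∣ Ps Ps-partition)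

      cancel : ∀ a b c → (a + c) - (b + c) ≡ a - b
      cancel = solve-∀

open import Data.Integer using (+_)

module LargestTightSets {n : ℕ} (M : Matroid n) (loopless : Loopless M)
    (B : Subset n) (B≢∅ : Nonempty B) (e : Fin n)
    (r'[B∪e]≡∣B∪e∣ : r'≡ M (B ∪ ⁅ e ⁆) (+ ∣ B ∪ ⁅ e ⁆ ∣)) where
  open import Data.Nat as ℕ using (NonZero; >-nonZero⁻¹)
  open import Data.Nat.Properties as ℕ using (m*n≢0)
  open import Data.Integer using (ℤ; 0ℤ; _+_; _*_; -_; _-_; _≤_; +≤+)
  open import Data.Integer.Properties
  open import Data.Integer.Tactic.RingSolver using (solve-∀)
  open import Data.Rational as ℚ using (_/_)
  import Data.Rational.Properties as ℚ
  open import Data.Fin.Subset using (⊥)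
  open import Data.Fin.Subset.Properties using (x∈p∪q⁺; x∈⁅x⁆; ⊥⊆; p⊆q⇒∣p∣≤∣q∣; ∪-identityˡ; ∣⁅x⁆∣≡1)
  open import Data.Sum using (inj₂)
  open import Data.Empty using (⊥-elim)
  open import Function.Bundles using (mk⇔; Equivalence)
  open import Relation.Nullary using (¬_; Dec; yes; no)
  open import Relation.Binary.PropositionalEquality
  open CommonDenominator
  open SubsetAlgebra using (∪-monoˡ-⊆)
  open SubmodularFunctions
  open MatroidSurplus M

  ∣B∣ 2∣B∣ : ℕ
  ∣B∣  = ∣ B ∣
  2∣B∣ = 2 ℕ.* ∣B∣

  instance
    ∣B∣≢0 : NonZero ∣B∣
    ∣B∣≢0 = nonempty⇒nonZero B B≢∅

    2∣B∣≢0 : NonZero 2∣B∣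
    2∣B∣≢0 = m*n≢0 2 ∣B∣

  F : Subset n → ℚ.ℚ
  F = f M B B≢∅ e

  scaledF : Subset n → ℤ
  scaledF X = + 2∣B∣ * surplus (X ∪ ⁅ e ⁆) - + ∣ X ∣

  F≡scaledF/2∣B∣ : ∀ X → F X ≡ scaledF X / 2∣B∣
  F≡scaledF/2∣B∣ X = i/1-j/n≡[n*i-j]/n (surplus (X ∪ ⁅ e ⁆)) (+ ∣ X ∣) 2∣B∣

  scaledF-submodular : Submodular scaledF
  scaledF-submodular =
    +-submodular (*-submodular (+ 2∣B∣) (∪ʳ-submodular ⁅ e ⁆ surplus-submodular)) -card-submodular

  Tight? : ∀ X → Dec (Tight M e X)
  Tight? X = 2r-1 M (X ∪ ⁅ e ⁆) ≟ + ∣ X ∪ ⁅ e ⁆ ∣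

  ⊥-tight : Tight M e ⊥
  ⊥-tight = subst (λ X → 2r-1 M X ≡ + ∣ X ∣) (sym (∪-identityˡ ⁅ e ⁆))
    (trans (2r-1[⁅x⁆]≡1 loopless e) (cong +_ (sym (∣⁅x⁆∣≡1 e))))

  tight⇒scaledF≡-∣X∣ : ∀ {X} → Tight M e X → scaledF X ≡ - + ∣ X ∣
  tight⇒scaledF≡-∣X∣ {X} tight = begin
    + 2∣B∣ * surplus (X ∪ ⁅ e ⁆) - + ∣ X ∣ ≡⟨ cong (λ s → + 2∣B∣ * s - + ∣ X ∣) surplus≡0 ⟩
    + 2∣B∣ * 0ℤ - + ∣ X ∣                  ≡⟨ cong (_- + ∣ X ∣) (*-zeroʳ (+ 2∣B∣)) ⟩
    0ℤ - + ∣ X ∣                            ≡⟨ +-identityˡ (- + ∣ X ∣) ⟩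
    - + ∣ X ∣                               ∎
    where
    open ≡-Reasoning
    surplus≡0 : surplus (X ∪ ⁅ e ⁆) ≡ 0ℤ
    surplus≡0 = Equivalence.to 2r-1≡∣X∣⇔surplus≡0 tight

  b≤[2b]*s-k : ∀ b k {s} → + 1 ≤ s → k ℕ.≤ b → + b ≤ + (2 ℕ.* b) * s - + k
  b≤[2b]*s-k b k {s} 1≤s k≤b = begin
    + b                       ≡⟨ [2b]-b≡b ⟨
    + (2 ℕ.* b) - + b         ≤⟨ +-monoʳ-≤ (+ (2 ℕ.* b)) (neg-mono-≤ (+≤+ k≤b)) ⟩
    + (2 ℕ.* b) - + k         ≡⟨ cong (_- + k) (*-identityʳ (+ (2 ℕ.* b))) ⟨
    + (2 ℕ.* b) * + 1 - + k   ≤⟨ +-monoˡ-≤ (- + k) (*-monoˡ-≤-nonNeg (+ (2 ℕ.* b)) 1≤s) ⟩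
    + (2 ℕ.* b) * s - + k     ∎
    where
    open ≤-Reasoning
    2x-x≡x : ∀ x → + 2 * x - x ≡ x
    2x-x≡x = solve-∀
    [2b]-b≡b : + (2 ℕ.* b) - + b ≡ + b
    [2b]-b≡b = trans (cong (_- + b) (pos-* 2 b)) (2x-x≡x (+ b))

  ¬tight⇒∣B∣≤scaledF : ∀ {X} → X ⊆ B → ¬ Tight M e X → + ∣B∣ ≤ scaledF X
  ¬tight⇒∣B∣≤scaledF {X} X⊆B ¬tight = b≤[2b]*s-k ∣B∣ ∣ X ∣ 1≤surplus (p⊆q⇒∣p∣≤∣q∣ X⊆B)
    where
    X∪e≢∅ : Nonempty (X ∪ ⁅ e ⁆)
    X∪e≢∅ = e , x∈p∪q⁺ (inj₂ (x∈⁅x⁆ e))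

    0≤surplus : 0ℤ ≤ surplus (X ∪ ⁅ e ⁆)
    0≤surplus = r'≡∣S∣⇒surplus-nonNeg loopless r'[B∪e]≡∣B∪e∣ (∪-monoˡ-⊆ X⊆B) X∪e≢∅

    1≤surplus : + 1 ≤ surplus (X ∪ ⁅ e ⁆)
    1≤surplus = i<j⇒suc[i]≤j (≤∧≢⇒< 0≤surplus
      (λ 0≡surplus → ¬tight (Equivalence.from 2r-1≡∣X∣⇔surplus≡0 (sym 0≡surplus))))

  largestTight⇒scaledF-minimiser : ∀ {J} → LargestTight M B e J → ∀ I → I ⊆ B → scaledF J ≤ scaledF I
  largestTight⇒scaledF-minimiser {J} (_ , J-tight , J-largest) I I⊆B with Tight? I
  ... | yes I-tight = begin
    scaledF J   ≡⟨ tight⇒scaledF≡-∣X∣ J-tight ⟩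
    - + ∣ J ∣   ≤⟨ neg-mono-≤ (+≤+ (J-largest I I⊆B I-tight)) ⟩
    - + ∣ I ∣   ≡⟨ tight⇒scaledF≡-∣X∣ I-tight ⟨
    scaledF I   ∎
    where open ≤-Reasoning
  ... | no I-loose = begin
    scaledF J   ≡⟨ tight⇒scaledF≡-∣X∣ J-tight ⟩
    - + ∣ J ∣   ≤⟨ neg-≤-pos ⟩
    + ∣B∣       ≤⟨ ¬tight⇒∣B∣≤scaledF I⊆B I-loose ⟩
    scaledF I   ∎
    where open ≤-Reasoning

  scaledF-minimiser⇒largestTight : ∀ {J} → J ⊆ B → (∀ I → I ⊆ B → scaledF J ≤ scaledF I) →
                                   LargestTight M B e J
  scaledF-minimiser⇒largestTight {J} J⊆B J-minimal = J⊆B , J-tight , J-largest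
    where
    J-tight : Tight M e J
    J-tight with Tight? J
    ... | yes tight = tight
    ... | no loose  = ⊥-elim (ℕ.<⇒≱ (>-nonZero⁻¹ ∣B∣) (drop‿+≤+ (begin
      + ∣B∣       ≤⟨ ¬tight⇒∣B∣≤scaledF J⊆B loose ⟩
      scaledF J   ≤⟨ J-minimal ⊥ ⊥⊆ ⟩
      scaledF ⊥   ≡⟨ tight⇒scaledF≡-∣X∣ ⊥-tight ⟩
      - + ∣ ⊥ {n} ∣ ≤⟨ neg-≤-pos ⟩
      + 0         ∎)))
      where open ≤-Reasoning

    J-largest : ∀ K → K ⊆ B → Tight M e K → ∣ K ∣ ℕ.≤ ∣ J ∣
    J-largest K K⊆B K-tight = drop‿+≤+ (neg-cancel-≤ (begin
      - + ∣ J ∣   ≡⟨ tight⇒scaledF≡-∣X∣ J-tight ⟨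
      scaledF J   ≤⟨ J-minimal K K⊆B ⟩
      scaledF K   ≡⟨ tight⇒scaledF≡-∣X∣ K-tight ⟩
      - + ∣ K ∣   ∎))
      where open ≤-Reasoning

  F-submodular : ∀ I J → F (I ∪ J) ℚ.+ F (I ∩ J) ℚ.≤ F I ℚ.+ F J
  F-submodular I J = begin
    F (I ∪ J) ℚ.+ F (I ∩ J)                           ≡⟨ cong₂ ℚ._+_ (F≡scaledF/2∣B∣ (I ∪ J)) (F≡scaledF/2∣B∣ (I ∩ J)) ⟩
    scaledF (I ∪ J) / 2∣B∣ ℚ.+ scaledF (I ∩ J) / 2∣B∣ ≡⟨ i/n+j/n≡[i+j]/n (scaledF (I ∪ J)) (scaledF (I ∩ J)) 2∣B∣ ⟩
    (scaledF (I ∪ J) + scaledF (I ∩ J)) / 2∣B∣        ≤⟨ /-monoˡ-≤ 2∣B∣ (submodular scaledF-submodular I J) ⟩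
    (scaledF I + scaledF J) / 2∣B∣                    ≡⟨ i/n+j/n≡[i+j]/n (scaledF I) (scaledF J) 2∣B∣ ⟨
    scaledF I / 2∣B∣ ℚ.+ scaledF J / 2∣B∣             ≡⟨ cong₂ ℚ._+_ (F≡scaledF/2∣B∣ I) (F≡scaledF/2∣B∣ J) ⟨
    F I ℚ.+ F J                                       ∎
    where open ℚ.≤-Reasoning

  F≤F⇔scaledF≤scaledF : ∀ I J → F I ℚ.≤ F J ⇔ scaledF I ≤ scaledF J
  F≤F⇔scaledF≤scaledF I J = mk⇔
    (λ FI≤FJ → /-cancelˡ-≤ 2∣B∣ (subst₂ ℚ._≤_ (F≡scaledF/2∣B∣ I) (F≡scaledF/2∣B∣ J) FI≤FJ))
    (λ hI≤hJ → subst₂ ℚ._≤_ (sym (F≡scaledF/2∣B∣ I)) (sym (F≡scaledF/2∣B∣ J)) (/-monoˡ-≤ 2∣B∣ hI≤hJ))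

  largestTight⇔F-minimiser : ∀ {J} → J ⊆ B → LargestTight M B e J ⇔ (∀ I → I ⊆ B → F J ℚ.≤ F I)
  largestTight⇔F-minimiser {J} J⊆B = mk⇔ F-minimiser largestTight
    where
    F-minimiser : LargestTight M B e J → ∀ I → I ⊆ B → F J ℚ.≤ F I
    F-minimiser J-largest I I⊆B =
      Equivalence.from (F≤F⇔scaledF≤scaledF J I) (largestTight⇒scaledF-minimiser J-largest I I⊆B)

    largestTight : (∀ I → I ⊆ B → F J ℚ.≤ F I) → LargestTight M B e J
    largestTight J-minimal = scaledF-minimiser⇒largestTight J⊆B scaledF-minimal
      where
      scaledF-minimal : ∀ I → I ⊆ B → scaledF J ≤ scaledF I
      scaledF-minimal I I⊆B = Equivalence.to (F≤F⇔scaledF≤scaledF J I) (J-minimal I I⊆B)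

open import Data.Rational using (_+_; _≤_)

lemma4p2 : ∀ {n : ℕ} (M : Matroid n) → Loopless M →
    (B : Subset n) (neB : Nonempty B) (e : Fin n) → e ∉ B →
    r'≡ M (B ∪ ⁅ e ⁆) (+ ∣ B ∪ ⁅ e ⁆ ∣) →
    (∀ (I J : Subset n) → I ⊆ B → J ⊆ B →
       f M B neB e (I ∪ J) + f M B neB e (I ∩ J) ≤ f M B neB e I + f M B neB e J)
    × (∀ (J : Subset n) → J ⊆ B →
         (LargestTight M B e J ⇔ (∀ (I : Subset n) → I ⊆ B → f M B neB e J ≤ f M B neB e I)))
lemma4p2 M loopless B B≢∅ e _ r'[B∪e]≡∣B∪e∣ =
  (λ I J _ _ → F-submodular I J) , λ J J⊆B → largestTight⇔F-minimiser J⊆B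
  where
  open LargestTightSets M loopless B B≢∅ e r'[B∪e]≡∣B∪e∣
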